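{- Let $(a_n)_{n\ge 0}$ be any sequence of complex numbers, and for $n\ge k\ge 0$ let $A_{n,k}=a_n$, $B_{n,k}=a_k$, $C_{n,k}=a_{n-k}$. Then the lower triangular matrices $(A_{n,k})_{n\ge k\ge 0}$, $(B_{n,k})_{n\ge k\ge 0}$, $(C_{n,k})_{n\ge k\ge 0}$ all belong to $SDR_\infty$.
   Context: All matrices are infinite lower triangular matrices $\mathscr{A}=(A_{n,k})_{n\ge k\ge 0}$ with complex entries; we set $A_{n,k}=0$ whenever $k>n$. For an integer $m\ge 3$, $\mathscr{A}$ is called an SDR-matrix of order $m$ (written $\mathscr{A}\in SDR_m$) if for all integers $n,k\ge 0$, all $2\le p\le m-1$ and all $0\le r\le p-1$, $$\prod_{i=0}^{r}A_{n+i,k+r-i}\prod_{i=0}^{p-r-1}A_{n+p-i,k+r+i+1}=\prod_{i=0}^{r}A_{n+p-i,k+p-r+i}\prod_{i=0}^{p-r-1}A_{n+i,k+p-r-i-1}.$$ $SDR_\infty$ denotes the set of matrices lying in $SDR_m$ for every $m\ge 3$. -}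

module Defs where

open import Level using (Level)
open import Algebra.Bundles using (CommutativeRing)
open import Data.Nat using (ℕ; zero; suc; _+_; _∸_; _≤_; _≤?_)
open import Relation.Nullary using (yes; no)

module _ {c ℓ : Level} (R : CommutativeRing c ℓ) where
  open CommutativeRing R using (Carrier; _≈_; _*_; 0#; 1#)

  Matrix : Set c
  Matrix = ℕ → ℕ → Carrier

  prod : ℕ → (ℕ → Carrier) → Carrier
  prod zero    f = 1#
  prod (suc m) f = prod m f * f m

  SDR : ℕ → Matrix → Set ℓ
  SDR m M = ∀ (n k p r : ℕ) → 2 ≤ p → p ≤ m ∸ 1 → r ≤ p ∸ 1 →
    (prod (suc r) (λ i → M (n + i) (k + r ∸ i))
      * prod (p ∸ r) (λ i → M (n + p ∸ i) (k + r + i + 1)))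
    ≈
    (prod (suc r) (λ i → M (n + p ∸ i) (k + p ∸ r + i))
      * prod (p ∸ r) (λ i → M (n + i) (k + p ∸ r ∸ i ∸ 1)))

  SDR∞ : Matrix → Set ℓ
  SDR∞ M = ∀ (m : ℕ) → 3 ≤ m → SDR m M

  lowerTri : (ℕ → ℕ → Carrier) → Matrix
  lowerTri f n k with k ≤? n
  ... | yes _ = f n k
  ... | no  _ = 0#

  matA : (ℕ → Carrier) → Matrix
  matA a = lowerTri (λ n k → a n)

  matB : (ℕ → Carrier) → Matrix
  matB a = lowerTri (λ n k → a k)

  matC : (ℕ → Carrier) → Matrix
  matC a = lowerTri (λ n k → a (n ∸ k))

module Submission where

-- Put p = r + q + 1. The four products of the SDR identity run along anti-diagonal segments:
-- on the left one of length r + 1 starting at (n , k + r) and one of length q + 1 starting at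
-- (n + r + 1 , k + p); on the right the same two lengths, swapped in position. For a lower
-- triangular matrix such a product vanishes exactly when its top-right cell lies above the
-- diagonal, and this happens for corresponding segments on both sides, so it suffices to check
-- the identity for the entry function f itself. If f (n , k) = a n, both sides multiply a over
-- the rows n, ..., n + p; if f (n , k) = a k, over the columns k, ..., k + p; and if
-- f (n , k) = a (n - k), f is constant along diagonals and each segment on the left is a
-- diagonal translate of the segment of the same length on the right.

open import Defs
open import Level using (Level)
open import Algebra.Bundles using (CommutativeRing)
open import Data.Nat using (ℕ; zero; suc; _+_; _∸_; _≤_; _<_; s≤s; _≤?_)
open import Data.Nat.Properties
  using ( +-identityʳ; +-suc; +-comm; +-assoc; +-cancelʳ-≤; +-monoˡ-≤; +-monoʳ-≤; ≤-trans
        ; m≤m+n; n<1+n; m<n⇒m<1+n; m<1+n⇒m≤n; m≤n⇒∃[o]m+o≡n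
        ; m∸n≤m; m+n∸n≡m; m+n∸m≡n; +-∸-assoc; ∸-+-assoc; m∸[m∸n]≡n; [m+n]∸[m+o]≡n∸o
        ; +-commutativeSemigroup )
open import Algebra.Properties.CommutativeSemigroup +-commutativeSemigroup using (xy∙z≈xz∙y)
open import Data.Nat.Tactic.RingSolver using (solve)
open import Data.List using ([]; _∷_)
open import Data.Product using (_×_; _,_)
open import Function using (_∘_)
open import Relation.Nullary using (¬_; yes; no)
open import Relation.Nullary.Negation using (contradiction)
import Relation.Binary.PropositionalEquality as ≡
open ≡ using (_≡_; cong; cong₂)

suc[m+n]∸m≡suc[n] : ∀ m n → suc (m + n) ∸ m ≡ suc n
suc[m+n]∸m≡suc[n] m n = ≡.trans (cong (_∸ m) (≡.sym (+-suc m n))) (m+n∸m≡n m (suc n))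

o+suc[m+n]∸m≡o+suc[n] : ∀ o m n → o + suc (m + n) ∸ m ≡ o + suc n
o+suc[m+n]∸m≡o+suc[n] o m n = ≡.trans (cong (_∸ m) rearrange) (m+n∸n≡m (o + suc n) m)
  where
  rearrange : o + suc (m + n) ≡ o + suc n + m
  rearrange = solve (o ∷ m ∷ n ∷ [])

o+suc[m+n]∸m∸i∸1≡o+n∸i : ∀ o m n i → o + suc (m + n) ∸ m ∸ i ∸ 1 ≡ o + n ∸ i
o+suc[m+n]∸m∸i∸1≡o+n∸i o m n i = begin
  o + suc (m + n) ∸ m ∸ i ∸ 1   ≡⟨ ∸-+-assoc (o + suc (m + n) ∸ m) i 1 ⟩
  o + suc (m + n) ∸ m ∸ (i + 1) ≡⟨ cong (o + suc (m + n) ∸ m ∸_) (+-comm i 1) ⟩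
  o + suc (m + n) ∸ m ∸ suc i   ≡⟨ cong (_∸ suc i) (o+suc[m+n]∸m≡o+suc[n] o m n) ⟩
  o + suc n ∸ suc i             ≡⟨ cong (_∸ suc i) (+-suc o n) ⟩
  o + n ∸ i                     ∎
  where open ≡.≡-Reasoning

y+m≤x⇒y+d+m≤x+d : ∀ x y m d → y + m ≤ x → y + d + m ≤ x + d
y+m≤x⇒y+d+m≤x+d x y m d le = ≡.subst (_≤ x + d) (≡.sym (xy∙z≈xz∙y y d m)) (+-monoˡ-≤ d le)

y+d+m≤x+d⇒y+m≤x : ∀ x y m d → y + d + m ≤ x + d → y + m ≤ x
y+d+m≤x+d⇒y+m≤x x y m d le = +-cancelʳ-≤ d (y + m) x (≡.subst (_≤ x + d) (xy∙z≈xz∙y y d m) le)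

module _ {c ℓ : Level} (R : CommutativeRing c ℓ) where
  open CommutativeRing R
    using ( Carrier; _≈_; _*_; 0#; refl; sym; trans; reflexive; setoid
          ; *-cong; *-congˡ; *-congʳ; *-assoc; *-comm; *-identityˡ; *-identityʳ; zeroˡ; zeroʳ )
  open import Relation.Binary.Reasoning.Setoid setoid

  prod-cong : ∀ m {f g : ℕ → Carrier} → (∀ i → i < m → f i ≈ g i) → prod R m f ≈ prod R m g
  prod-cong zero    f≈g = refl
  prod-cong (suc m) f≈g = *-cong (prod-cong m λ i i<m → f≈g i (m<n⇒m<1+n i<m)) (f≈g m (n<1+n m))

  prod-+ : ∀ m l (f : ℕ → Carrier) → prod R (m + l) f ≈ prod R m f * prod R l (λ i → f (m + i))
  prod-+ m zero    f rewrite +-identityʳ m = sym (*-identityʳ _)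
  prod-+ m (suc l) f rewrite +-suc m l     = trans (*-congʳ (prod-+ m l f)) (*-assoc _ _ _)

  prod-head : ∀ m (f : ℕ → Carrier) → prod R (suc m) f ≈ f 0 * prod R m (λ i → f (suc i))
  prod-head m f = trans (prod-+ 1 m f) (*-congʳ (*-identityˡ _))

  prod-reverse : ∀ m (f : ℕ → Carrier) → prod R (suc m) f ≈ prod R (suc m) (λ i → f (m ∸ i))
  prod-reverse zero    f = refl
  prod-reverse (suc m) f = begin
    prod R (suc m) f * f (suc m)                     ≈⟨ *-comm _ _ ⟩
    f (suc m) * prod R (suc m) f                     ≈⟨ *-congˡ (prod-reverse m f) ⟩
    f (suc m) * prod R (suc m) (λ i → f (m ∸ i))     ≈⟨ prod-head (suc m) (λ i → f (suc m ∸ i)) ⟨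
    prod R (suc (suc m)) (λ i → f (suc m ∸ i))       ∎

  x≈0⇒x*y≈0 : ∀ {x} y → x ≈ 0# → x * y ≈ 0#
  x≈0⇒x*y≈0 y x≈0 = trans (*-congʳ x≈0) (zeroˡ y)

  y≈0⇒x*y≈0 : ∀ x {y} → y ≈ 0# → x * y ≈ 0#
  y≈0⇒x*y≈0 x y≈0 = trans (*-congˡ y≈0) (zeroʳ x)

  prod-run-+ : ∀ (g : ℕ → Carrier) x m l →
    prod R m (λ i → g (x + i)) * prod R l (λ i → g (x + m + i)) ≈ prod R (m + l) (λ i → g (x + i))
  prod-run-+ g x m l =
    trans (*-congˡ (prod-cong l λ i _ → reflexive (cong g (+-assoc x m i)))) (sym (prod-+ m l _))

  prod-run-swap : ∀ (g : ℕ → Carrier) x m l →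
    prod R m (λ i → g (x + i)) * prod R l (λ i → g (x + m + i))
      ≈ prod R m (λ i → g (x + l + i)) * prod R l (λ i → g (x + i))
  prod-run-swap g x m l = begin
    prod R m (λ i → g (x + i)) * prod R l (λ i → g (x + m + i)) ≈⟨ prod-run-+ g x m l ⟩
    prod R (m + l) (λ i → g (x + i))                            ≡⟨ cong (λ s → prod R s (λ i → g (x + i))) (+-comm m l) ⟩
    prod R (l + m) (λ i → g (x + i))                            ≈⟨ prod-run-+ g x l m ⟨
    prod R l (λ i → g (x + i)) * prod R m (λ i → g (x + l + i)) ≈⟨ *-comm _ _ ⟩
    prod R m (λ i → g (x + l + i)) * prod R l (λ i → g (x + i)) ∎

  antidiagonal : Matrix R → ℕ → ℕ → ℕ → Carrier
  antidiagonal M m x y = prod R m (λ i → M (x + i) (y + (m ∸ suc i)))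

  -- The SDR identity for p = r + q + 1, with each of its four products read as an antidiagonal.
  Exchange : Matrix R → Set ℓ
  Exchange M = ∀ n k r q →
    antidiagonal M (suc r) n k * antidiagonal M (suc q) (n + suc r) (k + suc r)
      ≈ antidiagonal M (suc r) (n + suc q) (k + suc q) * antidiagonal M (suc q) n k

  antidiagonal-cols : ∀ (M : Matrix R) m x y → prod R (suc m) (λ i → M (x + i) (y + m ∸ i)) ≈ antidiagonal M (suc m) x y
  antidiagonal-cols M m x y =
    prod-cong (suc m) λ i i<1+m → reflexive (cong (M (x + i)) (+-∸-assoc y (m<1+n⇒m≤n i<1+m)))

  antidiagonal-rows : ∀ (M : Matrix R) m x y → prod R (suc m) (λ i → M (x + m ∸ i) (y + i)) ≈ antidiagonal M (suc m) x y
  antidiagonal-rows M m x y = trans (prod-reverse m (λ i → M (x + m ∸ i) (y + i))) (prod-cong (suc m) λ i i<1+m →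
    reflexive (cong (λ row → M row (y + (m ∸ i)))
      (≡.trans (+-∸-assoc x (m∸n≤m m i)) (cong (x +_) (m∸[m∸n]≡n (m<1+n⇒m≤n i<1+m))))))

  exchange⇒SDR : ∀ (M : Matrix R) → Exchange M → ∀ m → SDR R m M
  exchange⇒SDR M ex m n k (suc p) r (s≤s _) _ r≤p with m≤n⇒∃[o]m+o≡n r≤p
  ... | q , ≡.refl rewrite suc[m+n]∸m≡suc[n] r q =
    trans (*-cong left₁ left₂) (trans (ex n k r q) (sym (*-cong right₁ right₂)))
    where
    left₁ : prod R (suc r) (λ i → M (n + i) (k + r ∸ i)) ≈ antidiagonal M (suc r) n k
    left₁ = antidiagonal-cols M r n k

    left₂ : prod R (suc q) (λ i → M (n + suc (r + q) ∸ i) (k + r + i + 1))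
              ≈ antidiagonal M (suc q) (n + suc r) (k + suc r)
    left₂ = trans
      (prod-cong (suc q) λ i _ →
        reflexive (cong₂ M (cong (_∸ i) (≡.sym (+-assoc n (suc r) q))) (column i)))
      (antidiagonal-rows M q (n + suc r) (k + suc r))
      where
      column : ∀ i → k + r + i + 1 ≡ k + suc r + i
      column i = solve (k ∷ r ∷ i ∷ [])

    right₁ : prod R (suc r) (λ i → M (n + suc (r + q) ∸ i) (k + suc (r + q) ∸ r + i))
               ≈ antidiagonal M (suc r) (n + suc q) (k + suc q)
    right₁ = trans
      (prod-cong (suc r) λ i _ →
        reflexive (cong₂ M (cong (_∸ i) row) (cong (_+ i) (o+suc[m+n]∸m≡o+suc[n] k r q))))
      (antidiagonal-rows M r (n + suc q) (k + suc q))
      where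
      row : n + suc (r + q) ≡ n + suc q + r
      row = solve (n ∷ r ∷ q ∷ [])

    right₂ : prod R (suc q) (λ i → M (n + i) (k + suc (r + q) ∸ r ∸ i ∸ 1)) ≈ antidiagonal M (suc q) n k
    right₂ = trans
      (prod-cong (suc q) λ i _ → reflexive (cong (M (n + i)) (o+suc[m+n]∸m∸i∸1≡o+n∸i k r q i)))
      (antidiagonal-cols M q n k)

  lowerTri-≤ : ∀ (f : Matrix R) {x y} → y ≤ x → lowerTri R f x y ≡ f x y
  lowerTri-≤ f {x} {y} y≤x with y ≤? x
  ... | yes _   = ≡.refl
  ... | no  y≰x = contradiction y≤x y≰x

  lowerTri-≰ : ∀ (f : Matrix R) {x y} → ¬ y ≤ x → lowerTri R f x y ≡ 0#
  lowerTri-≰ f {x} {y} y≰x with y ≤? x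
  ... | yes y≤x = contradiction y≤x y≰x
  ... | no  _   = ≡.refl

  antidiagonal-lowerTri : ∀ (f : Matrix R) m x y → y + m ≤ x →
    antidiagonal (lowerTri R f) (suc m) x y ≈ antidiagonal f (suc m) x y
  antidiagonal-lowerTri f m x y y+m≤x = prod-cong (suc m) λ i _ →
    reflexive (lowerTri-≤ f (≤-trans (+-monoʳ-≤ y (m∸n≤m m i)) (≤-trans y+m≤x (m≤m+n x i))))

  -- The first factor is the top-right cell (x , y + m) of the segment.
  antidiagonal-lowerTri-≈0 : ∀ (f : Matrix R) m x y → ¬ y + m ≤ x → antidiagonal (lowerTri R f) (suc m) x y ≈ 0#
  antidiagonal-lowerTri-≈0 f m x y y+m≰x = trans (prod-head m _) (x≈0⇒x*y≈0 _ (reflexive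
    (lowerTri-≰ f (y+m≰x ∘ ≡.subst (y + m ≤_) (+-identityʳ x)))))

  lowerTri-exchange : ∀ f → Exchange f → Exchange (lowerTri R f)
  lowerTri-exchange f ex n k r q with k + r ≤? n | k + q ≤? n
  ... | yes k+r≤n | yes k+q≤n =
    trans (*-cong (antidiagonal-lowerTri f r n k k+r≤n)
                  (antidiagonal-lowerTri f q (n + suc r) (k + suc r) (y+m≤x⇒y+d+m≤x+d n k q (suc r) k+q≤n)))
          (trans (ex n k r q)
          (sym (*-cong (antidiagonal-lowerTri f r (n + suc q) (k + suc q) (y+m≤x⇒y+d+m≤x+d n k r (suc q) k+r≤n))
                       (antidiagonal-lowerTri f q n k k+q≤n))))
  ... | no k+r≰n | _ =
    trans (x≈0⇒x*y≈0 _ (antidiagonal-lowerTri-≈0 f r n k k+r≰n))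
          (sym (x≈0⇒x*y≈0 _ (antidiagonal-lowerTri-≈0 f r (n + suc q) (k + suc q)
                                (k+r≰n ∘ y+d+m≤x+d⇒y+m≤x n k r (suc q)))))
  ... | yes _ | no k+q≰n =
    trans (y≈0⇒x*y≈0 _ (antidiagonal-lowerTri-≈0 f q (n + suc r) (k + suc r)
                          (k+q≰n ∘ y+d+m≤x+d⇒y+m≤x n k q (suc r))))
          (sym (y≈0⇒x*y≈0 _ (antidiagonal-lowerTri-≈0 f q n k k+q≰n)))

  lowerTri-SDR∞ : ∀ f → Exchange f → SDR∞ R (lowerTri R f)
  lowerTri-SDR∞ f ex m _ = exchange⇒SDR (lowerTri R f) (lowerTri-exchange f ex) m

  rowConst-exchange : ∀ (g : ℕ → Carrier) → Exchange (λ x _ → g x)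
  rowConst-exchange g n k r q = prod-run-swap g n (suc r) (suc q)

  colConst-antidiagonal : ∀ (g : ℕ → Carrier) m x y → antidiagonal (λ _ y → g y) (suc m) x y ≈ prod R (suc m) (λ i → g (y + i))
  colConst-antidiagonal g m x y = trans (prod-reverse m (λ i → g (y + (m ∸ i)))) (prod-cong (suc m) λ i i<1+m →
    reflexive (cong (λ j → g (y + j)) (m∸[m∸n]≡n (m<1+n⇒m≤n i<1+m))))

  colConst-exchange : ∀ (g : ℕ → Carrier) → Exchange (λ _ y → g y)
  colConst-exchange g n k r q =
    trans (*-cong (colConst-antidiagonal g r n k) (colConst-antidiagonal g q (n + suc r) (k + suc r)))
          (trans (prod-run-swap g k (suc r) (suc q))
          (sym (*-cong (colConst-antidiagonal g r (n + suc q) (k + suc q)) (colConst-antidiagonal g q n k))))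

  Toeplitz : Matrix R → Set c
  Toeplitz M = ∀ x y d → M (x + d) (y + d) ≡ M x y

  antidiagonal-shift : ∀ {M} → Toeplitz M → ∀ m x y d → antidiagonal M m (x + d) (y + d) ≈ antidiagonal M m x y
  antidiagonal-shift {M} toeplitz m x y d = prod-cong m λ i _ → reflexive
    (≡.trans (cong₂ M (xy∙z≈xz∙y x d i) (xy∙z≈xz∙y y d (m ∸ suc i))) (toeplitz (x + i) (y + (m ∸ suc i)) d))

  toeplitz-exchange : ∀ {M} → Toeplitz M → Exchange M
  toeplitz-exchange toeplitz n k r q =
    *-cong (sym (antidiagonal-shift toeplitz (suc r) n k (suc q))) (antidiagonal-shift toeplitz (suc q) n k (suc r))

  ∸-toeplitz : ∀ (g : ℕ → Carrier) → Toeplitz (λ x y → g (x ∸ y))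
  ∸-toeplitz g x y d = cong g (≡.trans (cong₂ _∸_ (+-comm x d) (+-comm y d)) ([m+n]∸[m+o]≡n∸o d x y))

lemma2p3 : ∀ {c ℓ : Level} (R : CommutativeRing c ℓ) (a : ℕ → CommutativeRing.Carrier R) →
    SDR∞ R (matA R a) × SDR∞ R (matB R a) × SDR∞ R (matC R a)
lemma2p3 R a =
    lowerTri-SDR∞ R _ (rowConst-exchange R a)
  , lowerTri-SDR∞ R _ (colConst-exchange R a)
  , lowerTri-SDR∞ R _ (toeplitz-exchange R (∸-toeplitz R a))
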